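{- Let $p$ be the partially ordered pattern of length $4$ on the labels $\{1,2,3,4\}$ whose only relations are $1>2$ and $4>3$. Let $a(n)$ be the number of $n$-permutations avoiding $p$. Then $a(0)=1$, and for $n\geq 1$, $a(n)=2a(n-1)+2^{n-1}-2$, so that $a(n)=(n-2)2^{n-1}+2$. Also, $$\sum_{n\geq 0}a(n)x^n=\frac{1-4x+5x^2}{(1-x)(1-2x)^2}.$$
   Context: An $n$-permutation is a permutation $\pi=\pi_1\cdots\pi_n$ of $\{1,\dots,n\}$ written in one-line notation (for $n=0$ there is exactly one, the empty permutation). A partially ordered pattern (POP) $p$ of length $k$ is a partial order $<_P$ on the label set $\{1,\dots,k\}$. An occurrence of $p$ in $\pi$ is a subsequence $\pi_{i_1}\pi_{i_2}\cdots\pi_{i_k}$ with $1\leq i_1<\cdots<i_k\leq n$ such that $\pi_{i_j}<\pi_{i_m}$ whenever $j<_P m$ (no condition is imposed on pairs of incomparable labels). A permutation avoids $p$ if it contains no occurrence of $p$. -}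

module Defs where

open import Data.Nat using (ℕ; zero; suc; _∸_)
open import Data.Fin using (Fin; _<_; _<?_)
open import Data.Fin.Properties using (any?; all?; _≟_)
open import Data.Vec using (Vec; []; _∷_; lookup)
open import Data.List using (List; []; _∷_; length; filter; map; concatMap; foldr; upTo; allFin)
open import Data.Integer using (ℤ; +_; -_) renaming (_*_ to _*ℤ_; _+_ to _+ℤ_)
open import Data.Product using (∃; ∃-syntax; _×_; _,_)
open import Relation.Binary.PropositionalEquality using (_≡_)
open import Relation.Nullary using (Dec; ¬_)
open import Relation.Nullary.Decidable using (_×-dec_; ¬?; _→-dec_)

-- n-permutations, in one-line notation, as vectors π = π₁ ⋯ πₙ of
-- elements of Fin n (Fin n stands for {1,…,n}, shifted to {0,…,n-1};
-- only the relative order matters for pattern occurrences).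

-- a word of length n over Fin n is a permutation iff it is injective
IsPerm : ∀ {n} → Vec (Fin n) n → Set
IsPerm {n} π = ∀ (i j : Fin n) → lookup π i ≡ lookup π j → i ≡ j

isPerm? : ∀ {n} (π : Vec (Fin n) n) → Dec (IsPerm π)
isPerm? π = all? λ i → all? λ j → (lookup π i ≟ lookup π j) →-dec (i ≟ j)

-- The POP p of length 4 on labels {1,2,3,4} whose only relations are
-- 2 <_P 1 and 3 <_P 4.  An occurrence in π is a subsequence
-- π_{i₁} π_{i₂} π_{i₃} π_{i₄} with i₁ < i₂ < i₃ < i₄ such that
-- π_{i₂} < π_{i₁} and π_{i₃} < π_{i₄}.

Occurs : ∀ {n} → Vec (Fin n) n → Set
Occurs {n} π =
  ∃[ i₁ ] ∃[ i₂ ] ∃[ i₃ ] ∃[ i₄ ]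
    (i₁ < i₂ × i₂ < i₃ × i₃ < i₄ ×
     lookup π i₂ < lookup π i₁ × lookup π i₃ < lookup π i₄)

Avoids : ∀ {n} → Vec (Fin n) n → Set
Avoids π = ¬ Occurs π

occurs? : ∀ {n} (π : Vec (Fin n) n) → Dec (Occurs π)
occurs? π =
  any? λ i₁ → any? λ i₂ → any? λ i₃ → any? λ i₄ →
    (i₁ <? i₂) ×-dec (i₂ <? i₃) ×-dec (i₃ <? i₄) ×-dec
    (lookup π i₂ <? lookup π i₁) ×-dec (lookup π i₃ <? lookup π i₄)

avoids? : ∀ {n} (π : Vec (Fin n) n) → Dec (Avoids π)
avoids? π = ¬? (occurs? π)

allVecs : ∀ (m k : ℕ) → List (Vec (Fin k) m)
allVecs zero    k = [] ∷ []
allVecs (suc m) k = concatMap (λ x → map (x ∷_) (allVecs m k)) (allFin k)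

a : ℕ → ℕ
a n = length (filter (λ π → isPerm? π ×-dec avoids? π) (allVecs n n))

FPS : Set
FPS = ℕ → ℤ

_*ₛ_ : FPS → FPS → FPS
(f *ₛ g) n = foldr _+ℤ_ (+ 0) (map (λ k → f k *ℤ g (n ∸ k)) (upTo (suc n)))

-- polynomial with the given coefficient list (constant term first)
poly : List ℤ → FPS
poly []       _       = + 0
poly (c ∷ cs) zero    = c
poly (c ∷ cs) (suc n) = poly cs n

A : FPS
A n = + (a n)

-- Split a word into its first letter y and the rest w. The word avoids p iff w avoids p and,
-- after every letter of w smaller than y, the remaining letters are non-ascending. Relabelling
-- w by punchIn y turns this into the same condition over a smaller alphabet with y as a
-- threshold. Let b(n, t) count the n-permutations that avoid p even after a letter of value t
-- is put in front, so a(n) = b(n, 0). A first letter below t leaves a decreasing rest, and there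
-- is exactly one decreasing permutation, hence b(n + 1, t) = t + Σ_{t ≤ i ≤ n} b(n, i). Thus
-- b(n + 1, n + 1) = n + 1 and b(n + 1, t) + 1 = b(n + 1, t + 1) + b(n, t), from which induction on d
-- gives b(t + d, t) + 1 = t 2^d + a(d) for t ≥ 1 together with a(d + 1) + 2 = 2 a(d) + 2^d.

module Submission where

open import Defs
open import Level using (0ℓ)
open import Data.Nat as ℕ using (ℕ; zero; suc; z≤n; s≤s; z<s; s<s; _+_; _*_; _^_; _∸_)
open import Data.Nat.Properties
  using (≰⇒>; <⇒≱; ≮⇒≥; <-asym; <-≤-trans; ≤-refl; +-comm; +-assoc; +-identityʳ; *-identityʳ; +-suc; m≤m+n; +-cancelʳ-≡;
         +-0-commutativeMonoid)
open import Data.Nat.Tactic.RingSolver using (solve-∀)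
open import Algebra.Properties.CommutativeMonoid.Sum +-0-commutativeMonoid
  using (sum; sum-remove; sum-cong-≗; sum-init-last; sum-replicate-zero)
open import Data.Integer using (ℤ; +_; -_) renaming (_+_ to _+ℤ_; _*_ to _*ℤ_; _-_ to _-ℤ_)
open import Data.Integer.Properties using (pos-*)
import Data.Integer.Tactic.RingSolver as ℤ
open import Data.Bool using (true; false; if_then_else_)
open import Data.Fin as Fin using (Fin; zero; suc; toℕ; punchIn; inject₁; fromℕ)
open import Data.Fin.Properties
  using (_≟_; punchInᵢ≢i; punchIn-injective; punchIn-mono-≤; punchIn-cancel-≤; <⇒≢; ≤∧≢⇒<; toℕ<n; toℕ-inject₁; toℕ-fromℕ)
open import Data.Vec using (Vec; []; _∷_; map; lookup)
open import Data.Vec.Relation.Unary.All as All using (All; []; _∷_)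
import Data.Vec.Relation.Unary.All.Properties as All
open import Data.Vec.Relation.Unary.AllPairs as AllPairs using (AllPairs; []; _∷_; allPairs?)
import Data.Vec.Relation.Unary.AllPairs.Properties as AllPairs
open import Data.Vec.Relation.Unary.Unique.Propositional using (Unique)
open import Data.Vec.Relation.Unary.Unique.Propositional.Properties using (lookup-injective)
open import Data.List using (List; []; _∷_; _++_; length; filter; concatMap; tabulate; foldr; applyUpTo; upTo)
  renaming (map to mapL)
open import Data.List.Properties using (filter-≐; filter-none; filter-++; length-++; map-cong)
import Data.List.Relation.Unary.All as ListAll
open import Data.Product using (_×_; _,_; ∃-syntax; proj₁; proj₂)
open import Data.Unit using (⊤; tt)
open import Data.Empty using (⊥-elim)
open import Function using (_∘_; _∘′_; id)
open import Relation.Nullary using (Dec; ¬_; ¬?; does; yes; no)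
open import Relation.Nullary.Decidable using (_×-dec_; _→-dec_)
open import Relation.Unary using (Pred; Decidable; _≐_; _∩_)
open import Relation.Unary.Properties using (_∩?_)
open import Relation.Binary using (Rel)
open import Relation.Binary.PropositionalEquality
  using (_≡_; _≢_; refl; sym; trans; cong; cong₂; subst; module ≡-Reasoning)

variable
  k m n : ℕ

count : {A : Set} {P : Pred A 0ℓ} → Decidable P → List A → ℕ
count P? xs = length (filter P? xs)

module _ {A : Set} {P : Pred A 0ℓ} (P? : Decidable P) where

  count-≐ : {Q : Pred A 0ℓ} (Q? : Decidable Q) → P ≐ Q → ∀ xs → count P? xs ≡ count Q? xs
  count-≐ Q? P≐Q xs = cong length (filter-≐ P? Q? P≐Q xs)

  count-none : (∀ x → ¬ P x) → ∀ xs → count P? xs ≡ 0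
  count-none ¬P xs = cong length (filter-none P? (ListAll.universal ¬P xs))

  count-++ : ∀ xs ys → count P? (xs ++ ys) ≡ count P? xs + count P? ys
  count-++ xs ys = trans (cong length (filter-++ P? xs ys)) (length-++ (filter P? xs))

  count-map : {B : Set} (f : B → A) (xs : List B) → count P? (mapL f xs) ≡ count (P? ∘ f) xs
  count-map f []       = refl
  count-map f (x ∷ xs) with does (P? (f x))
  ... | true  = cong suc (count-map f xs)
  ... | false = count-map f xs

count-allVecs-suc : {P : Pred (Vec (Fin k) (suc m)) 0ℓ} (P? : Decidable P) →
  count P? (allVecs (suc m) k) ≡ sum (λ y → count (P? ∘ (y ∷_)) (allVecs m k))
count-allVecs-suc {k} {m} P? = count-prefixed id
  where
  count-prefixed : ∀ {j} (f : Fin j → Fin k) →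
    count P? (concatMap (λ y → mapL (y ∷_) (allVecs m k)) (tabulate f))
      ≡ sum (λ i → count (P? ∘ (f i ∷_)) (allVecs m k))
  count-prefixed {zero}  f = refl
  count-prefixed {suc j} f = trans (count-++ P? (mapL (f zero ∷_) (allVecs m k)) _)
    (cong₂ _+_ (count-map P? (f zero ∷_) (allVecs m k)) (count-prefixed (f ∘ suc)))

Fresh : Fin k → Vec (Fin k) m → Set
Fresh x = All (x ≢_)

fresh? : (x : Fin k) → Decidable (Fresh {m = m} x)
fresh? x = All.all? (λ y → ¬? (x ≟ y))

count-fresh : ∀ m (x : Fin (suc k)) {P : Pred (Vec (Fin (suc k)) m) 0ℓ} (P? : Decidable P) →
  count (fresh? x ∩? P?) (allVecs m (suc k)) ≡ count (P? ∘ map (punchIn x)) (allVecs m k)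
count-fresh zero    x P? with does (P? [])
... | true  = refl
... | false = refl
count-fresh {k} (suc m) x P? = begin
  count (fresh? x ∩? P?) (allVecs (suc m) (suc k))     ≡⟨ count-allVecs-suc (fresh? x ∩? P?) ⟩
  sum byFirst                                          ≡⟨ sum-remove byFirst ⟩
  byFirst x + sum (byFirst ∘ punchIn x)                ≡⟨ cong₂ _+_ byFirst-x (sum-cong-≗ byFirst-punchIn) ⟩
  sum (λ z → count (P? ∘ map (punchIn x) ∘ (z ∷_)) (allVecs m k))
                                                       ≡⟨ count-allVecs-suc (P? ∘ map (punchIn x)) ⟨
  count (P? ∘ map (punchIn x)) (allVecs (suc m) k)     ∎
  where
  open ≡-Reasoning
  byFirst : Fin (suc k) → ℕ
  byFirst y = count ((fresh? x ∩? P?) ∘ (y ∷_)) (allVecs m (suc k))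
  byFirst-x : byFirst x ≡ 0
  byFirst-x = count-none ((fresh? x ∩? P?) ∘ (x ∷_)) (λ { _ ((x≢x ∷ _) , _) → x≢x refl }) (allVecs m (suc k))
  byFirst-punchIn : ∀ z → byFirst (punchIn x z) ≡ count (P? ∘ map (punchIn x) ∘ (z ∷_)) (allVecs m k)
  byFirst-punchIn z = trans
    (count-≐ _ (fresh? x ∩? (P? ∘ (punchIn x z ∷_)))
      ((λ { ((_ ∷ fresh) , p) → fresh , p }) , (λ { (fresh , p) → ((punchInᵢ≢i x z ∘ sym) ∷ fresh) , p }))
      (allVecs m (suc k)))
    (count-fresh m x (P? ∘ (punchIn x z ∷_)))

count-after-letter : {P : Pred (Vec (Fin (suc k)) (suc m)) 0ℓ} {Q : Pred (Vec (Fin (suc k)) m) 0ℓ} {R : Pred (Vec (Fin k) m) 0ℓ}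
  (P? : Decidable P) (Q? : Decidable Q) (R? : Decidable R) (y : Fin (suc k)) →
  (λ w → P (y ∷ w)) ≐ (Fresh y ∩ Q) → (λ w → Q (map (punchIn y) w)) ≐ R →
  count (P? ∘ (y ∷_)) (allVecs m (suc k)) ≡ count R? (allVecs m k)
count-after-letter {k} {m} P? Q? R? y P≐ Q≐ = begin
  count (P? ∘ (y ∷_)) (allVecs m (suc k))     ≡⟨ count-≐ (P? ∘ (y ∷_)) (fresh? y ∩? Q?) P≐ (allVecs m (suc k)) ⟩
  count (fresh? y ∩? Q?) (allVecs m (suc k))  ≡⟨ count-fresh m y Q? ⟩
  count (Q? ∘ map (punchIn y)) (allVecs m k)  ≡⟨ count-≐ (Q? ∘ map (punchIn y)) R? Q≐ (allVecs m k) ⟩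
  count R? (allVecs m k)                      ∎
  where open ≡-Reasoning

module _ {A B : Set} {f : A → B} where

  all-map-≐ : {P : Pred B 0ℓ} {Q : Pred A 0ℓ} → (∀ {a} → P (f a) → Q a) → (∀ {a} → Q a → P (f a)) →
    (λ (w : Vec A m) → All P (map f w)) ≐ All Q
  all-map-≐ to from = All.map to ∘ All.map⁻ , All.map⁺ ∘ All.map from

  allPairs-map⁻ : {R : Rel B 0ℓ} {w : Vec A m} → AllPairs R (map f w) → AllPairs (λ a b → R (f a) (f b)) w
  allPairs-map⁻ {w = []}    []         = []
  allPairs-map⁻ {w = _ ∷ _} (px ∷ pxs) = All.map⁻ px ∷ allPairs-map⁻ pxs

  allPairs-map-≐ : {R : Rel B 0ℓ} {S : Rel A 0ℓ} →
    (∀ {a b} → R (f a) (f b) → S a b) → (∀ {a b} → S a b → R (f a) (f b)) →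
    (λ (w : Vec A m) → AllPairs R (map f w)) ≐ AllPairs S
  allPairs-map-≐ to from = AllPairs.map to ∘ allPairs-map⁻ , AllPairs.map⁺ ∘ AllPairs.map from

_∩-≐_ : {A : Set} {P P′ Q Q′ : Pred A 0ℓ} → P ≐ P′ → Q ≐ Q′ → (P ∩ Q) ≐ (P′ ∩ Q′)
(P⊆P′ , P′⊆P) ∩-≐ (Q⊆Q′ , Q′⊆Q) = (λ (p , q) → P⊆P′ p , Q⊆Q′ q) , (λ (p , q) → P′⊆P p , Q′⊆Q q)

module _ (x : Fin (suc k)) where

  punchIn-mono-< : {u v : Fin k} → u Fin.< v → punchIn x u Fin.< punchIn x v
  punchIn-mono-< {u} {v} u<v = ≰⇒> (<⇒≱ u<v ∘ punchIn-cancel-≤ x v u)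

  punchIn-cancel-< : {u v : Fin k} → punchIn x u Fin.< punchIn x v → u Fin.< v
  punchIn-cancel-< {u} {v} p = ≰⇒> (<⇒≱ p ∘ punchIn-mono-≤ x v u)

punchIn<pivot⁺ : (x : Fin (suc k)) (u : Fin k) → u Fin.< x → punchIn x u Fin.< x
punchIn<pivot⁺ (suc x) zero    _         = z<s
punchIn<pivot⁺ (suc x) (suc u) (s<s u<x) = s<s (punchIn<pivot⁺ x u u<x)

punchIn<pivot⁻ : (x : Fin (suc k)) (u : Fin k) → punchIn x u Fin.< x → u Fin.< x
punchIn<pivot⁻ (suc x) zero    _         = z<s
punchIn<pivot⁻ (suc x) (suc u) (s<s u<x) = s<s (punchIn<pivot⁻ x u u<x)

NonAscending : Vec (Fin k) m → Set
NonAscending = AllPairs Fin._≮_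

Descending : Vec (Fin k) m → Set
Descending = AllPairs Fin._>_

-- w can follow a letter of value t without completing an occurrence of p that starts at that letter.
AscentFreeBelow : ℕ → Vec (Fin k) m → Set
AscentFreeBelow t []      = ⊤
AscentFreeBelow t (y ∷ w) = (toℕ y ℕ.< t → NonAscending w) × AscentFreeBelow t w

PatternFree : Vec (Fin k) m → Set
PatternFree []      = ⊤
PatternFree (y ∷ w) = AscentFreeBelow (toℕ y) w × PatternFree w

unique? : Decidable (Unique {A = Fin k} {m})
unique? = allPairs? (λ u v → ¬? (u ≟ v))

nonAscending? : Decidable (NonAscending {k} {m})
nonAscending? = allPairs? (λ u v → ¬? (u Fin.<? v))

descending? : Decidable (Descending {k} {m})
descending? = allPairs? (λ u v → v Fin.<? u)

ascentFreeBelow? : ∀ t → Decidable (AscentFreeBelow {k} {m} t)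
ascentFreeBelow? t []      = yes tt
ascentFreeBelow? t (y ∷ w) = (toℕ y ℕ.<? t →-dec nonAscending? w) ×-dec ascentFreeBelow? t w

patternFree? : Decidable (PatternFree {k} {m})
patternFree? []      = yes tt
patternFree? (y ∷ w) = ascentFreeBelow? (toℕ y) w ×-dec patternFree? w

descending⇒unique : {w : Vec (Fin k) m} → Descending w → Unique w
descending⇒unique = AllPairs.map (λ v<u → <⇒≢ v<u ∘ sym)

descending⇒nonAscending : {w : Vec (Fin k) m} → Descending w → NonAscending w
descending⇒nonAscending = AllPairs.map <-asym

unique∧nonAscending⇒descending : {w : Vec (Fin k) m} → Unique w → NonAscending w → Descending w
unique∧nonAscending⇒descending uniq nonAsc =
  AllPairs.zipWith (λ (u≢v , u≮v) → ≤∧≢⇒< (≮⇒≥ u≮v) (u≢v ∘ sym)) (uniq , nonAsc)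

nonAscending⇒ascentFreeBelow : ∀ t {w : Vec (Fin k) m} → NonAscending w → AscentFreeBelow t w
nonAscending⇒ascentFreeBelow t []         = tt
nonAscending⇒ascentFreeBelow t (_ ∷ nonAsc) = (λ _ → nonAsc) , nonAscending⇒ascentFreeBelow t nonAsc

nonAscending⇒patternFree : {w : Vec (Fin k) m} → NonAscending w → PatternFree w
nonAscending⇒patternFree []                       = tt
nonAscending⇒patternFree {w = y ∷ _} (_ ∷ nonAsc) =
  nonAscending⇒ascentFreeBelow (toℕ y) nonAsc , nonAscending⇒patternFree nonAsc

ascentFreeBelow-mono : ∀ {s t} → s ℕ.≤ t → (w : Vec (Fin k) m) → AscentFreeBelow t w → AscentFreeBelow s w
ascentFreeBelow-mono s≤t []      _             = tt
ascentFreeBelow-mono s≤t (y ∷ w) (nonAsc , af) = (λ y<s → nonAsc (<-≤-trans y<s s≤t)) , ascentFreeBelow-mono s≤t w af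

ascentFreeBelow-zero : (w : Vec (Fin k) m) → AscentFreeBelow 0 w
ascentFreeBelow-zero []      = tt
ascentFreeBelow-zero (_ ∷ w) = (λ ()) , ascentFreeBelow-zero w

module _ (x : Fin (suc k)) where

  unique-punchIn : (λ (w : Vec (Fin k) m) → Unique (map (punchIn x) w)) ≐ Unique
  unique-punchIn = allPairs-map-≐ (λ ne → ne ∘ cong (punchIn x)) (λ ne → ne ∘ punchIn-injective x _ _)

  nonAscending-punchIn : (λ (w : Vec (Fin k) m) → NonAscending (map (punchIn x) w)) ≐ NonAscending
  nonAscending-punchIn = allPairs-map-≐ (λ nlt → nlt ∘ punchIn-mono-< x) (λ nlt → nlt ∘ punchIn-cancel-< x)

  descending-punchIn : (λ (w : Vec (Fin k) m) → Descending (map (punchIn x) w)) ≐ Descending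
  descending-punchIn = allPairs-map-≐ (punchIn-cancel-< x) (punchIn-mono-< x)

  ascentFreeBelow-punchIn : ∀ {s t} →
    (∀ {u} → toℕ (punchIn x u) ℕ.< s → toℕ u ℕ.< t) → (∀ {u} → toℕ u ℕ.< t → toℕ (punchIn x u) ℕ.< s) →
    (λ (w : Vec (Fin k) m) → AscentFreeBelow s (map (punchIn x) w)) ≐ AscentFreeBelow t
  ascentFreeBelow-punchIn {s = s} {t = t} <s⇒<t <t⇒<s = forth _ , back _
    where
    forth : (w : Vec (Fin k) m) → AscentFreeBelow s (map (punchIn x) w) → AscentFreeBelow t w
    forth []      _             = tt
    forth (y ∷ w) (nonAsc , af) = (λ y<t → proj₁ nonAscending-punchIn (nonAsc (<t⇒<s y<t))) , forth w af
    back : (w : Vec (Fin k) m) → AscentFreeBelow t w → AscentFreeBelow s (map (punchIn x) w)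
    back []      _             = tt
    back (y ∷ w) (nonAsc , af) = (λ y<s → proj₂ nonAscending-punchIn (nonAsc (<s⇒<t y<s))) , back w af

  patternFree-punchIn : (λ (w : Vec (Fin k) m) → PatternFree (map (punchIn x) w)) ≐ PatternFree
  patternFree-punchIn = forth _ , back _
    where
    forth : (w : Vec (Fin k) m) → PatternFree (map (punchIn x) w) → PatternFree w
    forth []      _         = tt
    forth (y ∷ w) (af , pf) = proj₁ (ascentFreeBelow-punchIn (punchIn-cancel-< x) (punchIn-mono-< x)) af , forth w pf
    back : (w : Vec (Fin k) m) → PatternFree w → PatternFree (map (punchIn x) w)
    back []      _         = tt
    back (y ∷ w) (af , pf) = proj₂ (ascentFreeBelow-punchIn (punchIn-cancel-< x) (punchIn-mono-< x)) af , back w pf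

module _ {A : Set} {R : Rel A 0ℓ} where

  allPairs-lookup⁺ : {w : Vec A m} → AllPairs R w → ∀ {i j} → i Fin.< j → R (lookup w i) (lookup w j)
  allPairs-lookup⁺ (px ∷ _)  {zero}  {suc j} _         = All.lookup⁺ px j
  allPairs-lookup⁺ (_ ∷ pxs) {suc i} {suc j} (s<s i<j) = allPairs-lookup⁺ pxs i<j

  allPairs-lookup⁻ : {w : Vec A m} → (∀ {i j} → i Fin.< j → R (lookup w i) (lookup w j)) → AllPairs R w
  allPairs-lookup⁻ {w = []}    _ = []
  allPairs-lookup⁻ {w = _ ∷ _} r = All.lookup⁻ (λ j → r {zero} {suc j} z<s) ∷ allPairs-lookup⁻ (r ∘ s<s)

lookup-injective⇒unique : {w : Vec (Fin k) m} → (∀ i j → lookup w i ≡ lookup w j → i ≡ j) → Unique w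
lookup-injective⇒unique inj = allPairs-lookup⁻ (λ i<j → <⇒≢ i<j ∘ inj _ _)

Occurrence : Vec (Fin k) m → Set
Occurrence w =
  ∃[ i₁ ] ∃[ i₂ ] ∃[ i₃ ] ∃[ i₄ ]
    (i₁ Fin.< i₂ × i₂ Fin.< i₃ × i₃ Fin.< i₄ ×
     lookup w i₂ Fin.< lookup w i₁ × lookup w i₃ Fin.< lookup w i₄)

ascentFreeBelow-lookup⁺ : ∀ {t} {w : Vec (Fin k) m} → AscentFreeBelow t w →
  ∀ {i j l} → i Fin.< j → j Fin.< l → toℕ (lookup w i) ℕ.< t → lookup w j Fin.≮ lookup w l
ascentFreeBelow-lookup⁺ {w = _ ∷ _} (nonAsc , _) {zero}  {suc j} {suc l} _         (s<s j<l) y<t = allPairs-lookup⁺ (nonAsc y<t) j<l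
ascentFreeBelow-lookup⁺ {w = _ ∷ _} (_ , af)     {suc i} {suc j} {suc l} (s<s i<j) (s<s j<l) = ascentFreeBelow-lookup⁺ af i<j j<l

ascentFreeBelow-lookup⁻ : ∀ {t} {w : Vec (Fin k) m} →
  (∀ {i j l} → i Fin.< j → j Fin.< l → toℕ (lookup w i) ℕ.< t → lookup w j Fin.≮ lookup w l) → AscentFreeBelow t w
ascentFreeBelow-lookup⁻ {w = []}    _ = tt
ascentFreeBelow-lookup⁻ {w = _ ∷ _} h =
  (λ y<t → allPairs-lookup⁻ (λ j<l → h z<s (s<s j<l) y<t)) , ascentFreeBelow-lookup⁻ (λ i<j j<l → h (s<s i<j) (s<s j<l))

patternFree⇒¬occurrence : {w : Vec (Fin k) m} → PatternFree w → ¬ Occurrence w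
patternFree⇒¬occurrence {w = _ ∷ _} (af , _) (zero , suc _ , suc _ , suc _ , _ , s<s i₂<i₃ , s<s i₃<i₄ , inv , asc) =
  ascentFreeBelow-lookup⁺ af i₂<i₃ i₃<i₄ inv asc
patternFree⇒¬occurrence {w = _ ∷ _} (_ , pf) (suc i₁ , suc i₂ , suc i₃ , suc i₄ , s<s p , s<s q , s<s r , occ) =
  patternFree⇒¬occurrence pf (i₁ , i₂ , i₃ , i₄ , p , q , r , occ)

¬occurrence⇒patternFree : {w : Vec (Fin k) m} → ¬ Occurrence w → PatternFree w
¬occurrence⇒patternFree {w = []}    _    = tt
¬occurrence⇒patternFree {w = _ ∷ _} ¬occ =
  ascentFreeBelow-lookup⁻ (λ i<j j<l inv asc → ¬occ (zero , _ , _ , _ , z<s , s<s i<j , s<s j<l , inv , asc)) ,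
  ¬occurrence⇒patternFree (λ (i₁ , i₂ , i₃ , i₄ , p , q , r , occ) → ¬occ (suc i₁ , suc i₂ , suc i₃ , suc i₄ , s<s p , s<s q , s<s r , occ))

DescendingBelow : ℕ → Vec (Fin k) m → Set
DescendingBelow t = Descending ∩ All ((ℕ._< t) ∘ toℕ)

descendingBelow? : ∀ t → Decidable (DescendingBelow {k} {m} t)
descendingBelow? t = descending? ∩? All.all? ((ℕ._<? t) ∘ toℕ)

descendingBelow⇒≤ : ∀ {t} {w : Vec (Fin k) m} → DescendingBelow t w → m ℕ.≤ t
descendingBelow⇒≤ {w = []}    _                          = ℕ.z≤n
descendingBelow⇒≤ {w = _ ∷ _} ((below ∷ desc) , (y<t ∷ _)) = <-≤-trans (s<s (descendingBelow⇒≤ (desc , below))) y<t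

descendingCount : ℕ → ℕ → ℕ
descendingCount m k = count (descending? {k} {m}) (allVecs m k)

descendingBelowCount : ℕ → ℕ → ℕ → ℕ
descendingBelowCount m k t = count (descendingBelow? {k} {m} t) (allVecs m k)

descendingCount-suc : ∀ m k → descendingCount (suc m) (suc k) ≡ sum (λ (y : Fin (suc k)) → descendingBelowCount m k (toℕ y))
descendingCount-suc m k = trans (count-allVecs-suc {suc k} {m} descending?) (sum-cong-≗ λ y →
  count-after-letter {k} {m} descending? (descendingBelow? (toℕ y)) (descendingBelow? (toℕ y)) y
    ((λ { (below ∷ desc) → All.map (λ z<y → <⇒≢ z<y ∘ sym) below , desc , below }) , (λ (_ , desc , below) → below ∷ desc))
    (descending-punchIn y ∩-≐ all-map-≐ (punchIn<pivot⁻ y _) (punchIn<pivot⁺ y _)))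

descendingBelowCount≡0 : ∀ m k {t} → t ℕ.< m → descendingBelowCount m k t ≡ 0
descendingBelowCount≡0 m k {t} t<m =
  count-none (descendingBelow? t) (λ _ desc → <⇒≱ t<m (descendingBelow⇒≤ desc)) (allVecs m k)

descendingBelowCount-alphabet : ∀ m k → descendingBelowCount m k k ≡ descendingCount m k
descendingBelowCount-alphabet m k =
  count-≐ (descendingBelow? k) descending? (proj₁ , λ desc → desc , All.universal toℕ<n _) (allVecs m k)

-- Only the first letter n leaves room for n smaller letters after it.
descendingCount-square : ∀ n → descendingCount n n ≡ 1
descendingCount-square zero    = refl
descendingCount-square (suc n) = begin
  descendingCount (suc n) (suc n)              ≡⟨ descendingCount-suc n n ⟩
  sum byFirst                                  ≡⟨ sum-init-last byFirst ⟩
  sum (byFirst ∘ inject₁) + byFirst (fromℕ n)  ≡⟨ cong₂ _+_ (trans (sum-cong-≗ byFirst-inject₁) (sum-replicate-zero n)) byFirst-last ⟩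
  0 + 1                                        ∎
  where
  open ≡-Reasoning
  byFirst : Fin (suc n) → ℕ
  byFirst y = descendingBelowCount n n (toℕ y)
  byFirst-inject₁ : ∀ i → byFirst (inject₁ i) ≡ 0
  byFirst-inject₁ i = descendingBelowCount≡0 n n (subst (ℕ._< n) (sym (toℕ-inject₁ i)) (toℕ<n i))
  byFirst-last : byFirst (fromℕ n) ≡ 1
  byFirst-last rewrite toℕ-fromℕ n = trans (descendingBelowCount-alphabet n n) (descendingCount-square n)

AvoiderAfter : ℕ → Vec (Fin k) m → Set
AvoiderAfter t = Unique ∩ (PatternFree ∩ AscentFreeBelow t)

avoiderAfter? : ∀ t → Decidable (AvoiderAfter {k} {m} t)
avoiderAfter? t = unique? ∩? (patternFree? ∩? ascentFreeBelow? t)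

avoiderCount : ℕ → ℕ → ℕ → ℕ
avoiderCount m k t = count (avoiderAfter? {k} {m} t) (allVecs m k)

avoiderCount-suc : ∀ m k t → avoiderCount (suc m) (suc k) t ≡
  sum (λ (y : Fin (suc k)) → if does (toℕ y ℕ.<? t) then descendingCount m k else avoiderCount m k (toℕ y))
avoiderCount-suc m k t = trans (count-allVecs-suc {suc k} {m} (avoiderAfter? t)) (sum-cong-≗ byFirst)
  where
  byFirst : ∀ y → count (avoiderAfter? t ∘ (y ∷_)) (allVecs m (suc k))
                ≡ (if does (toℕ y ℕ.<? t) then descendingCount m k else avoiderCount m k (toℕ y))
  byFirst y = split (toℕ y ℕ.<? t)
    where
    split : (y<?t : Dec (toℕ y ℕ.< t)) → count (avoiderAfter? t ∘ (y ∷_)) (allVecs m (suc k))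
          ≡ (if does y<?t then descendingCount m k else avoiderCount m k (toℕ y))
    split (yes y<t) = count-after-letter {k} {m} (avoiderAfter? t) descending? descending? y
        ((λ { ((fresh ∷ uniq) , _ , (nonAsc , _)) → fresh , unique∧nonAscending⇒descending uniq (nonAsc y<t) }) ,
         (λ (fresh , desc) → let nonAsc = descending⇒nonAscending desc in
            (fresh ∷ descending⇒unique desc) ,
            (nonAscending⇒ascentFreeBelow _ nonAsc , nonAscending⇒patternFree nonAsc) ,
            ((λ _ → nonAsc) , nonAscending⇒ascentFreeBelow t nonAsc)))
        (descending-punchIn y)
    split (no y≮t) = count-after-letter {k} {m} (avoiderAfter? t) (avoiderAfter? (toℕ y)) (avoiderAfter? (toℕ y)) y
        ((λ { ((fresh ∷ uniq) , (af , pf) , _) → fresh , uniq , pf , af }) ,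
         (λ { (fresh , uniq , pf , af) → (fresh ∷ uniq) , (af , pf) , (⊥-elim ∘ y≮t , ascentFreeBelow-mono (≮⇒≥ y≮t) _ af) }))
        (unique-punchIn y ∩-≐ (patternFree-punchIn y ∩-≐ ascentFreeBelow-punchIn y (punchIn<pivot⁻ y _) (punchIn<pivot⁺ y _)))

a≡avoiderCount : ∀ n → a n ≡ avoiderCount n n 0
a≡avoiderCount n = count-≐ (λ π → isPerm? π ×-dec avoids? π) (avoiderAfter? 0)
  ((λ (perm , avoid) → lookup-injective⇒unique perm , ¬occurrence⇒patternFree avoid , ascentFreeBelow-zero _) ,
   (λ (uniq , pf , _) → lookup-injective uniq , patternFree⇒¬occurrence pf))
  (allVecs n n)

onesBelow : ℕ → (ℕ → ℕ) → ℕ → ℕ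
onesBelow t f i = if does (i ℕ.<? t) then 1 else f i

sum-onesBelow-≤ : ∀ N {t} f → N ℕ.≤ t → sum {N} (onesBelow t f ∘ toℕ) ≡ N
sum-onesBelow-≤ zero    f _         = refl
sum-onesBelow-≤ (suc N) f (s≤s N≤t) = cong suc (sum-onesBelow-≤ N (f ∘ suc) N≤t)

sum-onesBelow-suc : ∀ N {t} f → t ℕ.< N → sum {N} (onesBelow t f ∘ toℕ) + 1 ≡ sum {N} (onesBelow (suc t) f ∘ toℕ) + f t
sum-onesBelow-suc (suc N) {zero}  f _         = trans (+-comm (f 0 + rest) 1) (cong suc (+-comm (f 0) rest))
  where rest = sum {N} (f ∘ suc ∘ toℕ)
sum-onesBelow-suc (suc N) {suc t} f (s<s t<N) = cong suc (sum-onesBelow-suc N (f ∘ suc) t<N)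

avoiderCount-square-suc : ∀ n t → avoiderCount (suc n) (suc n) t ≡ sum {suc n} (onesBelow t (avoiderCount n n) ∘ toℕ)
avoiderCount-square-suc n t = trans (avoiderCount-suc n n t) (sum-cong-≗ {suc n} λ y →
  cong (λ d → if does (toℕ y ℕ.<? t) then d else avoiderCount n n (toℕ y)) (descendingCount-square n))

avoiderCount-full : ∀ n → avoiderCount (suc n) (suc n) (suc n) ≡ suc n
avoiderCount-full n = trans (avoiderCount-square-suc n (suc n)) (sum-onesBelow-≤ (suc n) (avoiderCount n n) ≤-refl)

avoiderCount-step : ∀ n t → t ℕ.≤ n →
  avoiderCount (suc n) (suc n) t + 1 ≡ avoiderCount (suc n) (suc n) (suc t) + avoiderCount n n t
avoiderCount-step n t t≤n = begin
  avoiderCount (suc n) (suc n) t + 1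
    ≡⟨ cong (_+ 1) (avoiderCount-square-suc n t) ⟩
  sum {suc n} (onesBelow t (avoiderCount n n) ∘ toℕ) + 1
    ≡⟨ sum-onesBelow-suc (suc n) (avoiderCount n n) (s≤s t≤n) ⟩
  sum {suc n} (onesBelow (suc t) (avoiderCount n n) ∘ toℕ) + avoiderCount n n t
    ≡⟨ cong (_+ avoiderCount n n t) (avoiderCount-square-suc n (suc t)) ⟨
  avoiderCount (suc n) (suc n) (suc t) + avoiderCount n n t
    ∎
  where open ≡-Reasoning

module TriangleRecurrence (f : ℕ → ℕ → ℕ) (f-empty : f 0 0 ≡ 1)
  (f-full : ∀ n → f (suc n) (suc n) ≡ suc n)
  (f-step : ∀ n t → t ℕ.≤ n → f (suc n) t + 1 ≡ f (suc n) (suc t) + f n t) where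

  f-offset : ∀ d t → f (suc t + d) (suc t) + 1 ≡ suc t * 2 ^ d + f d 0
  f-recurrence : ∀ d → f (suc d) 0 + 2 ≡ 2 * f d 0 + 2 ^ d

  f-recurrence d = combine (f-step d 0 z≤n) (f-offset d 0)
    where
    open ≡-Reasoning
    right-swap : ∀ a b c → (a + b) + c ≡ (a + c) + b
    right-swap = solve-∀
    doubled : ∀ P U → (1 * P + U) + U ≡ 2 * U + P
    doubled = solve-∀
    combine : ∀ {V Y U P} → V + 1 ≡ Y + U → Y + 1 ≡ 1 * P + U → V + 2 ≡ 2 * U + P
    combine {V} {Y} {U} {P} V+1 Y+1 = begin
      V + 2              ≡⟨ +-assoc V 1 1 ⟨
      (V + 1) + 1        ≡⟨ cong (_+ 1) V+1 ⟩
      (Y + U) + 1        ≡⟨ right-swap Y U 1 ⟩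
      (Y + 1) + U        ≡⟨ cong (_+ U) Y+1 ⟩
      (1 * P + U) + U    ≡⟨ doubled P U ⟩
      2 * U + P          ∎

  f-offset zero    t rewrite +-identityʳ t = cong₂ _+_ (trans (f-full t) (sym (*-identityʳ (suc t)))) (sym f-empty)
  f-offset (suc d) t rewrite +-suc t d =
    combine (f d 0) (2 ^ d) (f-step (suc t + d) (suc t) (s≤s (m≤m+n t d))) (f-offset d (suc t)) (f-offset d t) (f-recurrence d)
    where
    open ≡-Reasoning
    split : ∀ a b → (a + b) + 2 ≡ (a + 1) + (b + 1)
    split = solve-∀
    regroup : ∀ t P U → (suc (suc t) * P + U) + (suc t * P + U) ≡ suc t * (2 * P) + (2 * U + P)
    regroup = solve-∀
    combine : ∀ {X Y Z V} U P → X + 1 ≡ Y + Z → Y + 1 ≡ suc (suc t) * P + U → Z + 1 ≡ suc t * P + U → V + 2 ≡ 2 * U + P →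
              X + 1 ≡ suc t * (2 * P) + V
    combine {X} {Y} {Z} {V} U P X+1 Y+1 Z+1 V+2 = +-cancelʳ-≡ 2 (X + 1) (suc t * (2 * P) + V) (begin
      (X + 1) + 2                                ≡⟨ cong (_+ 2) X+1 ⟩
      (Y + Z) + 2                                ≡⟨ split Y Z ⟩
      (Y + 1) + (Z + 1)                          ≡⟨ cong₂ _+_ Y+1 Z+1 ⟩
      (suc (suc t) * P + U) + (suc t * P + U)    ≡⟨ regroup t P U ⟩
      suc t * (2 * P) + (2 * U + P)              ≡⟨ cong (λ x → suc t * (2 * P) + x) V+2 ⟨
      suc t * (2 * P) + (V + 2)                  ≡⟨ +-assoc (suc t * (2 * P)) V 2 ⟨
      (suc t * (2 * P) + V) + 2                  ∎)

*ₛ-congˡ : ∀ {f f′ : FPS} (g : FPS) → (∀ j → f j ≡ f′ j) → ∀ k → (f *ₛ g) k ≡ (f′ *ₛ g) k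
*ₛ-congˡ g f≗f′ k = cong (foldr _+ℤ_ (+ 0)) (map-cong (λ j → cong (_*ℤ g (k ∸ j)) (f≗f′ j)) (upTo (suc k)))

*ₛ-cubicˡ : ∀ (f g : FPS) → (∀ j → f (4 + j) ≡ + 0) → ∀ k →
  (f *ₛ g) (3 + k) ≡ f 0 *ℤ g (3 + k) +ℤ (f 1 *ℤ g (2 + k) +ℤ (f 2 *ℤ g (1 + k) +ℤ (f 3 *ℤ g k +ℤ + 0)))
*ₛ-cubicˡ f g f-cubic k =
  cong (λ s → f 0 *ℤ g (3 + k) +ℤ (f 1 *ℤ g (2 + k) +ℤ (f 2 *ℤ g (1 + k) +ℤ (f 3 *ℤ g k +ℤ s))))
    (vanishing k (λ j → 4 + j) (λ j → cong (_*ℤ g (k ∸ suc j)) (f-cubic j)))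
  where
  vanishing : ∀ i (σ : ℕ → ℕ) → (∀ j → f (σ j) *ℤ g (3 + k ∸ σ j) ≡ + 0) →
    foldr _+ℤ_ (+ 0) (mapL (λ j → f j *ℤ g (3 + k ∸ j)) (applyUpTo σ i)) ≡ + 0
  vanishing zero    σ σ-zero = refl
  vanishing (suc i) σ σ-zero = cong₂ _+ℤ_ (σ-zero 0) (vanishing i (σ ∘′ suc) (λ j → σ-zero (suc j)))

cubic : FPS
cubic = poly (+ 1 ∷ - + 5 ∷ + 8 ∷ - + 4 ∷ [])

cubic-expansion : ∀ k → (poly (+ 1 ∷ - + 1 ∷ []) *ₛ (poly (+ 1 ∷ - + 2 ∷ []) *ₛ poly (+ 1 ∷ - + 2 ∷ []))) k ≡ cubic k
cubic-expansion 0 = refl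
cubic-expansion 1 = refl
cubic-expansion 2 = refl
cubic-expansion 3 = refl
cubic-expansion (suc (suc (suc (suc k)))) =
  trans (*ₛ-cubicˡ (poly (+ 1 ∷ - + 1 ∷ [])) square (λ _ → refl) (suc k))
        (cong₂ (λ s₄ s₃ → + 1 *ℤ s₄ +ℤ (- + 1 *ℤ s₃ +ℤ (+ 0 +ℤ (+ 0 +ℤ + 0)))) (square-expansion (4 + k)) (square-expansion (3 + k)))
  where
  square : FPS
  square = poly (+ 1 ∷ - + 2 ∷ []) *ₛ poly (+ 1 ∷ - + 2 ∷ [])
  square-expansion : ∀ k → square k ≡ poly (+ 1 ∷ - + 4 ∷ + 4 ∷ []) k
  square-expansion 0 = refl
  square-expansion 1 = refl
  square-expansion 2 = refl
  square-expansion (suc (suc (suc k))) = *ₛ-cubicˡ (poly (+ 1 ∷ - + 2 ∷ [])) (poly (+ 1 ∷ - + 2 ∷ [])) (λ _ → refl) k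

module DoublingRecurrence (u : ℕ → ℕ) (u-rec : ∀ n → u (suc n) + 2 ≡ 2 * u n + 2 ^ n) where

  u-recℤ : ∀ n → + u (suc n) ≡ + 2 *ℤ + u n +ℤ + 2 ^ n -ℤ + 2
  u-recℤ n = begin
    + u (suc n)                          ≡⟨ add-sub (+ u (suc n)) ⟩
    + (u (suc n) + 2) -ℤ + 2             ≡⟨ cong (λ x → + x -ℤ + 2) (u-rec n) ⟩
    + (2 * u n) +ℤ + 2 ^ n -ℤ + 2        ≡⟨ cong (λ x → x +ℤ + 2 ^ n -ℤ + 2) (pos-* 2 (u n)) ⟩
    + 2 *ℤ + u n +ℤ + 2 ^ n -ℤ + 2       ∎
    where
    open ≡-Reasoning
    add-sub : ∀ x → x ≡ x +ℤ + 2 -ℤ + 2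
    add-sub = ℤ.solve-∀

  u-closed-form : u 0 ≡ 1 → ∀ n → + u (suc n) ≡ (+ n -ℤ + 1) *ℤ + (2 ^ n) +ℤ + 2
  u-closed-form u₀ zero    = trans (u-recℤ 0) (cong (λ x → + 2 *ℤ + x +ℤ + 1 -ℤ + 2) u₀)
  u-closed-form u₀ (suc n) = begin
    + u (suc (suc n))
      ≡⟨ u-recℤ (suc n) ⟩
    + 2 *ℤ + u (suc n) +ℤ + 2 ^ suc n -ℤ + 2
      ≡⟨ cong₂ (λ x p → + 2 *ℤ x +ℤ p -ℤ + 2) (u-closed-form u₀ n) (pos-* 2 (2 ^ n)) ⟩
    + 2 *ℤ ((+ n -ℤ + 1) *ℤ + 2 ^ n +ℤ + 2) +ℤ + 2 *ℤ + 2 ^ n -ℤ + 2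
      ≡⟨ doubling (+ n) (+ 2 ^ n) ⟩
    (+ suc n -ℤ + 1) *ℤ (+ 2 *ℤ + 2 ^ n) +ℤ + 2
      ≡⟨ cong (λ p → (+ suc n -ℤ + 1) *ℤ p +ℤ + 2) (pos-* 2 (2 ^ n)) ⟨
    (+ suc n -ℤ + 1) *ℤ + 2 ^ suc n +ℤ + 2
      ∎
    where
    open ≡-Reasoning
    doubling : ∀ N P → + 2 *ℤ ((N -ℤ + 1) *ℤ P +ℤ + 2) +ℤ + 2 *ℤ P -ℤ + 2 ≡ (+ 1 +ℤ N -ℤ + 1) *ℤ (+ 2 *ℤ P) +ℤ + 2
    doubling = ℤ.solve-∀

  cubic-annihilates : ∀ i → (cubic *ₛ (+_ ∘′ u)) (3 + i) ≡ + 0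
  cubic-annihilates i = trans (*ₛ-cubicˡ cubic (+_ ∘′ u) (λ _ → refl) i)
    (cancel (+ u i) (+ u (1 + i)) (+ u (2 + i)) (+ u (3 + i)) (+ 2 ^ i)
      (u-recℤ i)
      (trans (u-recℤ (1 + i)) (cong (λ p → + 2 *ℤ + u (1 + i) +ℤ p -ℤ + 2) (pos-* 2 (2 ^ i))))
      (trans (u-recℤ (2 + i)) (cong (λ p → + 2 *ℤ + u (2 + i) +ℤ p -ℤ + 2)
        (trans (pos-* 2 (2 ^ suc i)) (cong (+ 2 *ℤ_) (pos-* 2 (2 ^ i)))))))
    where
    cancel : ∀ u₀ u₁ u₂ u₃ P → u₁ ≡ + 2 *ℤ u₀ +ℤ P -ℤ + 2 → u₂ ≡ + 2 *ℤ u₁ +ℤ + 2 *ℤ P -ℤ + 2 →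
      u₃ ≡ + 2 *ℤ u₂ +ℤ + 2 *ℤ (+ 2 *ℤ P) -ℤ + 2 →
      + 1 *ℤ u₃ +ℤ (- + 5 *ℤ u₂ +ℤ (+ 8 *ℤ u₁ +ℤ (- + 4 *ℤ u₀ +ℤ + 0))) ≡ + 0
    cancel u₀ _ _ _ P refl refl refl = identity u₀ P
      where
      identity : ∀ u₀ P → + 1 *ℤ (+ 2 *ℤ (+ 2 *ℤ (+ 2 *ℤ u₀ +ℤ P -ℤ + 2) +ℤ + 2 *ℤ P -ℤ + 2) +ℤ + 2 *ℤ (+ 2 *ℤ P) -ℤ + 2)
        +ℤ (- + 5 *ℤ (+ 2 *ℤ (+ 2 *ℤ u₀ +ℤ P -ℤ + 2) +ℤ + 2 *ℤ P -ℤ + 2)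
        +ℤ (+ 8 *ℤ (+ 2 *ℤ u₀ +ℤ P -ℤ + 2) +ℤ (- + 4 *ℤ u₀ +ℤ + 0))) ≡ + 0
      identity = ℤ.solve-∀

a-recurrence : ∀ n → a (suc n) + 2 ≡ 2 * a n + 2 ^ n
a-recurrence n rewrite a≡avoiderCount (suc n) | a≡avoiderCount n = f-recurrence n
  where open TriangleRecurrence (λ n t → avoiderCount n n t) refl avoiderCount-full avoiderCount-step

open DoublingRecurrence a a-recurrence

a-generatingFunction : ∀ k →
  ((poly (+ 1 ∷ - + 1 ∷ []) *ₛ (poly (+ 1 ∷ - + 2 ∷ []) *ₛ poly (+ 1 ∷ - + 2 ∷ []))) *ₛ A) k ≡ poly (+ 1 ∷ - + 4 ∷ + 5 ∷ []) k
a-generatingFunction 0 = refl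
a-generatingFunction 1 = refl
a-generatingFunction 2 = refl
a-generatingFunction (suc (suc (suc i))) = trans (*ₛ-congˡ A cubic-expansion (3 + i)) (cubic-annihilates i)

theorem15 : (a 0 ≡ 1)
    × (∀ (n : ℕ) → a (suc n) + 2 ≡ 2 * a n + 2 ^ n)
    × (∀ (n : ℕ) → + a (suc n) ≡ (+ n -ℤ + 1) *ℤ + (2 ^ n) +ℤ + 2)
    × (∀ (k : ℕ) →
    ((poly (+ 1 ∷ - + 1 ∷ []) *ₛ (poly (+ 1 ∷ - + 2 ∷ []) *ₛ poly (+ 1 ∷ - + 2 ∷ []))) *ₛ A) k
    ≡ poly (+ 1 ∷ - + 4 ∷ + 5 ∷ []) k)
theorem15 = refl , a-recurrence , u-closed-form refl , a-generatingFunction
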